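{- Let $H$ be an abelian group, $N\ge2$, and let $(\Delta(i))_{i=-N}^{N-1}$ be a sequence in $H$ that is APAP with period $p\in[2,N]$. Then for any $k\in\mathbb{Z}_{\ge0}$, the sum of any $kp$ consecutive terms $\Delta(s)+\Delta(s+1)+\cdots+\Delta(s+kp-1)$ of the sequence (with all indices in $\{ -N,\ldots,N-1\}$) whose first index $s$ is not a multiple of $p$ equals $k\cdot B_\Delta$, where $B_\Delta=\Delta(1)+\cdots+\Delta(p-2)$.
   Context: A sequence $(\Delta(i))_{i=-N}^{N-1}$ in an abelian group $H$ is APAP (almost periodic almost palindromic) with period $p\in[2,N]$ if: (i) $\Delta(i+p)=\Delta(i)$ whenever $i\not\equiv -1,0\pmod p$ (and both indices lie in the range); (ii) $\Delta(j-1)+\Delta(j)=0$ for all $j\in\{ -N+1,\ldots,N-1\}$ with $p\mid j$; (iii) $\Delta(p-1-i)=\Delta(i)$ for all $i=1,\ldots,p-2$. -}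

module Defs where

open import Level using (Level; _⊔_)
open import Algebra.Bundles using (AbelianGroup)
open import Data.Nat as ℕ using (ℕ; zero; suc)
open import Data.Integer as ℤ using (ℤ; +_; -_; _+_; _-_; _≤_)
open import Data.Integer.Divisibility using (_∣_)
open import Data.Product using (_×_)
open import Relation.Nullary using (¬_)

InRange : ℕ → ℤ → Set
InRange N i = (- (+ N) ≤ i) × (i ≤ + N - + 1)

module _ {c ℓ : Level} (G : AbelianGroup c ℓ) where
  open AbelianGroup G using (Carrier; _≈_; _∙_; ε)

  sumFrom : (ℤ → Carrier) → ℤ → ℕ → Carrier
  sumFrom Δ s zero    = ε
  sumFrom Δ s (suc n) = Δ s ∙ sumFrom Δ (s + + 1) n

  times : ℕ → Carrier → Carrier
  times zero    x = ε
  times (suc k) x = x ∙ times k x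

  B : (ℤ → Carrier) → ℕ → Carrier
  B Δ p = sumFrom Δ (+ 1) (p ℕ.∸ 2)

  -- (Δ(i))_{i=-N}^{N-1} (only values on the range matter) is APAP with period p
  record APAP (N p : ℕ) (Δ : ℤ → Carrier) : Set (c ⊔ ℓ) where
    field
      period-ge2 : 2 ℕ.≤ p
      period-leN : p ℕ.≤ N
      almost-periodic : ∀ i → InRange N i → InRange N (i + + p) →
        ¬ (+ p ∣ (i + + 1)) → ¬ (+ p ∣ i) → Δ (i + + p) ≈ Δ i
      boundary : ∀ j → InRange N j → InRange N (j - + 1) → + p ∣ j →
        Δ (j - + 1) ∙ Δ j ≈ ε
      almost-palindromic : ∀ (i : ℕ) → 1 ℕ.≤ i → i ℕ.≤ p ℕ.∸ 2 →
        Δ (+ (p ℕ.∸ 1 ℕ.∸ i)) ≈ Δ (+ i)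

{-# OPTIONS --safe #-}
-- Write every admissible start as s = m·p + a with 1 ≤ a < p. The window of length p
-- from s consists of the residues a, …, p-2 of block m, the pair Δ(mp+p-1), Δ((m+1)p),
-- which cancels by the boundary condition, and the residues 1, …, a-1 of block m+1.
-- Interior residues are never ≡ 0, -1 (mod p), so almost periodicity moves them to
-- block 0 one period at a time, staying inside the range; the two pieces then add up
-- to Δ(1) + ⋯ + Δ(p-2) = B_Δ. Summing over consecutive windows gives k · B_Δ.
module Submission where

open import Defs
open import Level using (Level)
open import Algebra.Bundles using (AbelianGroup)
open import Data.Nat as ℕ using (ℕ)
open import Data.Integer as ℤ using (ℤ; +_; _+_)
open import Data.Integer.Divisibility using (_∣_)
open import Relation.Nullary using (¬_)

open import Data.Nat using (zero; suc; _<_; z≤n; s≤s)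
open import Data.Integer using (_*_; -[1+_]; 0ℤ; 1ℤ; -1ℤ)
open import Data.Product using (_,_)
open import Data.Integer.DivMod using (a≡a%ℕn+[a/ℕn]*n; n%ℕd<d)
open import Data.Nat.Divisibility using (∣⇒≤)
import Data.Nat.Properties as ℕₚ
import Data.Integer.Properties as ℤₚ
import Data.Integer.Divisibility.Signed as Signed
import Data.Nat.Tactic.RingSolver as ℕ-Solver
import Data.Integer.Tactic.RingSolver as ℤ-Solver
import Relation.Binary.PropositionalEquality as ≡
open ≡ using (_≡_; cong; subst)
import Relation.Binary.Reasoning.Setoid as SetoidReasoning

module _ {c ℓ : Level} (G : AbelianGroup c ℓ) where
  open AbelianGroup G

  sumFrom-++ : ∀ Δ s a b →
               sumFrom G Δ s (a ℕ.+ b) ≈ sumFrom G Δ s a ∙ sumFrom G Δ (s + + a) b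
  sumFrom-++ Δ s zero    b =
    sym (trans (identityˡ _) (reflexive (cong (λ z → sumFrom G Δ z b) (ℤₚ.+-identityʳ s))))
  sumFrom-++ Δ s (suc a) b = begin
    Δ s ∙ sumFrom G Δ (s + + 1) (a ℕ.+ b)
      ≈⟨ ∙-congˡ (sumFrom-++ Δ (s + + 1) a b) ⟩
    Δ s ∙ (sumFrom G Δ (s + + 1) a ∙ sumFrom G Δ (s + + 1 + + a) b)
      ≈⟨ assoc _ _ _ ⟨
    (Δ s ∙ sumFrom G Δ (s + + 1) a) ∙ sumFrom G Δ (s + + 1 + + a) b
      ≈⟨ ∙-congˡ (reflexive (cong (λ z → sumFrom G Δ z b) (ℤₚ.+-assoc s (+ 1) (+ a)))) ⟩
    (Δ s ∙ sumFrom G Δ (s + + 1) a) ∙ sumFrom G Δ (s + + suc a) b ∎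
    where open SetoidReasoning setoid

  sumFrom-cong : ∀ {Δ Δ′} n {s s′} → (∀ t → t < n → Δ (s + + t) ≈ Δ′ (s′ + + t)) →
                 sumFrom G Δ s n ≈ sumFrom G Δ′ s′ n
  sumFrom-cong zero    eq = refl
  sumFrom-cong {Δ} {Δ′} (suc n) {s} {s′} eq = ∙-cong head (sumFrom-cong n tail)
    where
    head : Δ s ≈ Δ′ s′
    head = ≡.subst₂ (λ i j → Δ i ≈ Δ′ j) (ℤₚ.+-identityʳ s) (ℤₚ.+-identityʳ s′)
                    (eq 0 (s≤s z≤n))
    tail : ∀ t → t < n → Δ (s + + 1 + + t) ≈ Δ′ (s′ + + 1 + + t)
    tail t t<n = ≡.subst₂ (λ i j → Δ i ≈ Δ′ j) (≡.sym (ℤₚ.+-assoc s (+ 1) (+ t)))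
                   (≡.sym (ℤₚ.+-assoc s′ (+ 1) (+ t))) (eq (suc t) (s≤s t<n))

Window : ℕ → ℤ → ℕ → Set
Window N s n = ∀ t → t < n → InRange N (s + + t)

module _ {N : ℕ} where

  InRange-between : ∀ {i j k} → InRange N i → InRange N k → i ℤ.≤ j → j ℤ.≤ k →
                    InRange N j
  InRange-between (-N≤i , _) (_ , k≤top) i≤j j≤k =
    ℤₚ.≤-trans -N≤i i≤j , ℤₚ.≤-trans j≤k k≤top

  InRange-pos : ∀ {a} → a < N → InRange N (+ a)
  InRange-pos a<N =
    ℤₚ.neg-≤-pos , subst (+ _ ℤ.≤_) (ℤₚ.+-comm -1ℤ (+ N)) (ℤₚ.i<j⇒i≤pred[j] (ℤ.+<+ a<N))

  Window-head : ∀ {s n} → Window N s (suc n) → InRange N s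
  Window-head {s} W = subst (InRange N) (ℤₚ.+-identityʳ s) (W 0 (s≤s z≤n))

  Window-++ˡ : ∀ s a {b} → Window N s (a ℕ.+ b) → Window N s a
  Window-++ˡ s a {b} W t t<a = W t (ℕₚ.<-≤-trans t<a (ℕₚ.m≤m+n a b))

  Window-++ʳ : ∀ s a {b} → Window N s (a ℕ.+ b) → Window N (s + + a) b
  Window-++ʳ s a W t t<b =
    subst (InRange N) (≡.sym (ℤₚ.+-assoc s (+ a) (+ t))) (W (a ℕ.+ t) (ℕₚ.+-monoʳ-< a t<b))

module Blocks (p : ℕ) where

  P : ℤ
  P = + p

  infixl 6 _·p+_
  _·p+_ : ℤ → ℕ → ℤ
  m ·p+ a = m * P + + a

  ·p+-+ : ∀ m a b → m ·p+ a + + b ≡ m ·p+ (a ℕ.+ b)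
  ·p+-+ m a b = ℤₚ.+-assoc (m * P) (+ a) (+ b)

  ·p+-carry : ∀ m b → m ·p+ (p ℕ.+ b) ≡ (m + 1ℤ) ·p+ b
  ·p+-carry m b = carry m P (+ b)
    where carry : ∀ m P b → m * P + (P + b) ≡ (m + 1ℤ) * P + b
          carry = ℤ-Solver.solve-∀

  ·p+-suc : ∀ m a → (m + 1ℤ) ·p+ a ≡ m ·p+ a + P
  ·p+-suc m a = ≡.sym (begin
    m ·p+ a + P      ≡⟨ ·p+-+ m a p ⟩
    m ·p+ (a ℕ.+ p)  ≡⟨ cong (m ·p+_) (ℕₚ.+-comm a p) ⟩
    m ·p+ (p ℕ.+ a)  ≡⟨ ·p+-carry m a ⟩
    (m + 1ℤ) ·p+ a   ∎)
    where open ≡.≡-Reasoning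

  ·p+-+-carry : ∀ m a e j → e ℕ.+ suc a ≡ p → m ·p+ a + + e + + suc j ≡ (m + 1ℤ) ·p+ j
  ·p+-+-carry m a e j e+a+1≡p = begin
    m ·p+ a + + e + + suc j         ≡⟨ ℤₚ.+-assoc (m ·p+ a) (+ e) (+ suc j) ⟩
    m ·p+ a + + (e ℕ.+ suc j)       ≡⟨ ·p+-+ m a (e ℕ.+ suc j) ⟩
    m ·p+ (a ℕ.+ (e ℕ.+ suc j))     ≡⟨ cong (m ·p+_) (shuffle a e j) ⟩
    m ·p+ (e ℕ.+ suc a ℕ.+ j)       ≡⟨ cong (λ n → m ·p+ (n ℕ.+ j)) e+a+1≡p ⟩
    m ·p+ (p ℕ.+ j)                 ≡⟨ ·p+-carry m j ⟩
    (m + 1ℤ) ·p+ j                  ∎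
    where
    open ≡.≡-Reasoning
    shuffle : ∀ a e j → a ℕ.+ (e ℕ.+ suc j) ≡ e ℕ.+ suc a ℕ.+ j
    shuffle = ℕ-Solver.solve-∀

  ·p+-monoˡ-≤ : ∀ {m m′} a → m ℤ.≤ m′ → m ·p+ a ℤ.≤ m′ ·p+ a
  ·p+-monoˡ-≤ a m≤m′ = ℤₚ.+-monoˡ-≤ (+ a) (ℤₚ.*-monoʳ-≤-nonNeg P m≤m′)

  ∣·p+0 : ∀ m → P ∣ m ·p+ 0
  ∣·p+0 m = Signed.∣⇒∣ᵤ (Signed.divides m (ℤₚ.+-identityʳ (m * P)))

  ∤·p+ : ∀ m {a} → 0 < a → a < p → ¬ P ∣ m ·p+ a
  ∤·p+ m {a} 0<a a<p P∣ = ℕₚ.<⇒≱ a<p (∣⇒≤ {{ℕ.>-nonZero 0<a}} p∣a)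
    where
    p∣a : P ∣ + a
    p∣a = Signed.∣⇒∣ᵤ (Signed.∣m+n∣m⇒∣n (Signed.∣ᵤ⇒∣ P∣) (Signed.∣n⇒∣m*n m Signed.∣-refl))

  module _ .{{_ : ℕ.NonZero p}} where

    ·p+-quotient-remainder : ∀ s → s ≡ (s ℤ./ℕ p) ·p+ (s ℤ.%ℕ p)
    ·p+-quotient-remainder s =
      ≡.trans (a≡a%ℕn+[a/ℕn]*n s p) (ℤₚ.+-comm (+ (s ℤ.%ℕ p)) ((s ℤ./ℕ p) * P))

    ∤⇒%ℕ>0 : ∀ {s} → ¬ P ∣ s → 0 < s ℤ.%ℕ p
    ∤⇒%ℕ>0 {s} P∤s = ℕₚ.n≢0⇒n>0 λ r≡0 →
      P∤s (subst (P ∣_) (≡.sym (s≡q·p+0 r≡0)) (∣·p+0 q))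
      where
      q : ℤ
      q = s ℤ./ℕ p
      s≡q·p+0 : s ℤ.%ℕ p ≡ 0 → s ≡ q ·p+ 0
      s≡q·p+0 r≡0 = ≡.trans (·p+-quotient-remainder s) (cong (q ·p+_) r≡0)

module Periods {c ℓ : Level} (G : AbelianGroup c ℓ) {N p : ℕ}
               {Δ : ℤ → AbelianGroup.Carrier G} (apap : APAP G N p Δ) where
  open AbelianGroup G
  open APAP apap
  open Blocks p
  open SetoidReasoning setoid

  instance
    p-nonZero : ℕ.NonZero p
    p-nonZero = ℕ.>-nonZero (ℕₚ.<-≤-trans (s≤s z≤n) period-ge2)

  ∑ : ℤ → ℕ → Carrier
  ∑ = sumFrom G Δ

  boundary-pair : ∀ {x} → InRange N x → InRange N (x + + 1) → P ∣ x + + 1 →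
                  Δ x ∙ Δ (x + + 1) ≈ ε
  boundary-pair {x} x∈ x+1∈ P∣ =
    subst (λ i → Δ i ∙ Δ (x + + 1) ≈ ε) x+1-1≡x
      (boundary (x + + 1) x+1∈ (subst (InRange N) (≡.sym x+1-1≡x) x∈) P∣)
    where
    x+1-1≡x : x + + 1 ℤ.- + 1 ≡ x
    x+1-1≡x = ≡.trans (ℤₚ.+-assoc x (+ 1) -1ℤ) (ℤₚ.+-identityʳ x)

  sum-across-boundary : ∀ {x} r → InRange N x → InRange N (x + + 1) → P ∣ x + + 1 →
                        ∑ x (2 ℕ.+ r) ≈ ∑ (x + + 2) r
  sum-across-boundary {x} r x∈ x+1∈ P∣ = begin
    Δ x ∙ (Δ (x + + 1) ∙ ∑ (x + + 1 + + 1) r) ≈⟨ assoc _ _ _ ⟨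
    (Δ x ∙ Δ (x + + 1)) ∙ ∑ (x + + 1 + + 1) r ≈⟨ ∙-congʳ (boundary-pair x∈ x+1∈ P∣) ⟩
    ε ∙ ∑ (x + + 1 + + 1) r                   ≈⟨ identityˡ _ ⟩
    ∑ (x + + 1 + + 1) r                       ≡⟨ cong (λ i → ∑ i r) (ℤₚ.+-assoc x (+ 1) (+ 1)) ⟩
    ∑ (x + + 2) r                             ∎

  module _ {a} (0<a : 0 < a) (a+1<p : suc a < p) where

    a<p : a < p
    a<p = ℕₚ.<-trans (ℕₚ.n<1+n a) a+1<p

    interior-inRange : InRange N (+ a)
    interior-inRange = InRange-pos (ℕₚ.<-≤-trans a<p period-leN)

    Δ-next-period : ∀ m → InRange N (m ·p+ a) → InRange N ((m + 1ℤ) ·p+ a) →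
                    Δ ((m + 1ℤ) ·p+ a) ≈ Δ (m ·p+ a)
    Δ-next-period m m∈ m+1∈ = ≡.subst (λ i → Δ i ≈ Δ (m ·p+ a)) (≡.sym (·p+-suc m a))
      (almost-periodic (m ·p+ a) m∈ (subst (InRange N) (·p+-suc m a) m+1∈) next-∤ here-∤)
      where
      here-∤ : ¬ P ∣ m ·p+ a
      here-∤ = ∤·p+ m 0<a a<p
      next-∤ : ¬ P ∣ m ·p+ a + + 1
      next-∤ P∣ = ∤·p+ m (s≤s z≤n) a+1<p
        (subst (P ∣_) (≡.trans (·p+-+ m a 1) (cong (m ·p+_) (ℕₚ.+-comm a 1))) P∣)

    Δ-periodic : ∀ m n → InRange N (m ·p+ a) → InRange N ((m + + n) ·p+ a) →
                 Δ ((m + + n) ·p+ a) ≈ Δ (m ·p+ a)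
    Δ-periodic m zero    _  _     = reflexive (cong (λ k → Δ (k ·p+ a)) (ℤₚ.+-identityʳ m))
    Δ-periodic m (suc n) m∈ m+n∈ = begin
      Δ ((m + + suc n) ·p+ a)    ≡⟨ cong (λ k → Δ (k ·p+ a)) (ℤₚ.+-assoc m 1ℤ (+ n)) ⟨
      Δ ((m + 1ℤ + + n) ·p+ a)   ≈⟨ Δ-periodic (m + 1ℤ) n m+1∈ m+1+n∈ ⟩
      Δ ((m + 1ℤ) ·p+ a)         ≈⟨ Δ-next-period m m∈ m+1∈ ⟩
      Δ (m ·p+ a)                ∎
      where
      m+1+n∈ : InRange N ((m + 1ℤ + + n) ·p+ a)
      m+1+n∈ = subst (λ k → InRange N (k ·p+ a)) (≡.sym (ℤₚ.+-assoc m 1ℤ (+ n))) m+n∈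
      m+1∈ : InRange N ((m + 1ℤ) ·p+ a)
      m+1∈ = InRange-between m∈ m+n∈ (·p+-monoˡ-≤ a (ℤₚ.i≤i+j m 1ℤ))
                                    (·p+-monoˡ-≤ a (ℤₚ.+-monoʳ-≤ m (ℤ.+≤+ (s≤s z≤n))))

    Δ-interior : ∀ m → InRange N (m ·p+ a) → Δ (m ·p+ a) ≈ Δ (+ a)
    Δ-interior (+ n)    m∈ = Δ-periodic 0ℤ n interior-inRange m∈
    Δ-interior -[1+ n ] m∈ = sym (≡.subst (λ k → Δ (k ·p+ a) ≈ Δ (-[1+ n ] ·p+ a)) cancel
      (Δ-periodic -[1+ n ] (suc n) m∈ 0∈))
      where
      cancel : -[1+ n ] + + suc n ≡ 0ℤ
      cancel = ℤₚ.+-inverseˡ (+ suc n)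
      0∈ : InRange N ((-[1+ n ] + + suc n) ·p+ a)
      0∈ = subst (λ k → InRange N (k ·p+ a)) (≡.sym cancel) interior-inRange

  interior-sum : ∀ m {a} n → 0 < a → a ℕ.+ n < p → Window N (m ·p+ a) n →
              ∑ (m ·p+ a) n ≈ ∑ (+ a) n
  interior-sum m {a} n 0<a a+n<p W = sumFrom-cong G n λ t t<n →
    ≡.subst (λ i → Δ i ≈ Δ (+ (a ℕ.+ t))) (≡.sym (·p+-+ m a t))
      (Δ-interior (0<a+t t) (a+t+1<p t t<n) m (subst (InRange N) (·p+-+ m a t) (W t t<n)))
    where
    0<a+t : ∀ t → 0 < a ℕ.+ t
    0<a+t t = ℕₚ.<-≤-trans 0<a (ℕₚ.m≤m+n a t)
    a+t+1<p : ∀ t → t < n → suc (a ℕ.+ t) < p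
    a+t+1<p t t<n =
      ℕₚ.≤-<-trans (subst (ℕ._≤ a ℕ.+ n) (ℕₚ.+-suc a t) (ℕₚ.+-monoʳ-≤ a t<n)) a+n<p

  period-sum-·p+ : ∀ m {a} → 0 < a → a < p → Window N (m ·p+ a) p → ∑ (m ·p+ a) p ≈ B G Δ p
  period-sum-·p+ m {suc r} 0<a a<p W = begin
    ∑ s p                          ≡⟨ cong (∑ s) p≡ ⟨
    ∑ s (e ℕ.+ (2 ℕ.+ r))          ≈⟨ sumFrom-++ G Δ s e (2 ℕ.+ r) ⟩
    ∑ s e ∙ ∑ x (2 ℕ.+ r)          ≈⟨ ∙-cong head-block
                                               (sum-across-boundary r x∈ x+1∈ P∣x+1) ⟩
    ∑ (+ suc r) e ∙ ∑ (x + + 2) r  ≈⟨ ∙-congˡ tail-block ⟩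
    ∑ (+ suc r) e ∙ ∑ (+ 1) r      ≈⟨ comm _ _ ⟩
    ∑ (+ 1) r ∙ ∑ (+ suc r) e      ≈⟨ sumFrom-++ G Δ (+ 1) r e ⟨
    ∑ (+ 1) (r ℕ.+ e)              ≡⟨ cong (∑ (+ 1)) r+e≡p-2 ⟩
    B G Δ p                        ∎
    where
    s : ℤ
    s = m ·p+ suc r
    e : ℕ
    e = p ℕ.∸ suc (suc r)
    x : ℤ
    x = s + + e
    p≡ : e ℕ.+ suc (suc r) ≡ p
    p≡ = ℕₚ.m∸n+n≡m a<p
    r+e≡p-2 : r ℕ.+ e ≡ p ℕ.∸ 2
    r+e≡p-2 = ≡.trans (ℕₚ.+-comm r e)
                (≡.trans (≡.sym (ℕₚ.+-∸-assoc e (s≤s (s≤s z≤n)))) (cong (ℕ._∸ 2) p≡))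
    x+ : ∀ j → x + + suc j ≡ (m + 1ℤ) ·p+ j
    x+ j = ·p+-+-carry m (suc r) e j p≡
    W′ : Window N s (e ℕ.+ (2 ℕ.+ r))
    W′ = subst (Window N s) (≡.sym p≡) W
    Wx : Window N x (2 ℕ.+ r)
    Wx = Window-++ʳ s e W′
    x∈ : InRange N x
    x∈ = Window-head Wx
    x+1∈ : InRange N (x + + 1)
    x+1∈ = Window-head (Window-++ʳ x 1 Wx)
    P∣x+1 : P ∣ x + + 1
    P∣x+1 = subst (P ∣_) (≡.sym (x+ 0)) (∣·p+0 (m + 1ℤ))
    head-block : ∑ s e ≈ ∑ (+ suc r) e
    head-block = interior-sum m e 0<a (ℕₚ.≤-reflexive a+e+1≡p) (Window-++ˡ s e W′)
      where
      a+e+1≡p : suc (suc r ℕ.+ e) ≡ p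
      a+e+1≡p = ≡.trans (cong suc (ℕₚ.+-comm (suc r) e))
                  (≡.trans (≡.sym (ℕₚ.+-suc e (suc r))) p≡)
    tail-block : ∑ (x + + 2) r ≈ ∑ (+ 1) r
    tail-block = ≡.subst (λ i → ∑ i r ≈ ∑ (+ 1) r) (≡.sym (x+ 1))
      (interior-sum (m + 1ℤ) r (s≤s z≤n) a<p
        (subst (λ i → Window N i r) (x+ 1) (Window-++ʳ x 2 Wx)))

  period-sum : ∀ s → ¬ P ∣ s → Window N s p → ∑ s p ≈ B G Δ p
  period-sum s P∤s = ≡.subst (λ i → Window N i p → ∑ i p ≈ B G Δ p)
    (≡.sym (·p+-quotient-remainder s)) (period-sum-·p+ (s ℤ./ℕ p) (∤⇒%ℕ>0 {s} P∤s) (n%ℕd<d s p))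

  sum-of-periods : ∀ k s → Window N s (k ℕ.* p) → ¬ P ∣ s →
                   ∑ s (k ℕ.* p) ≈ times G k (B G Δ p)
  sum-of-periods zero    s W P∤s = refl
  sum-of-periods (suc k) s W P∤s = begin
    ∑ s (p ℕ.+ k ℕ.* p)            ≈⟨ sumFrom-++ G Δ s p (k ℕ.* p) ⟩
    ∑ s p ∙ ∑ (s + P) (k ℕ.* p)     ≈⟨ ∙-cong (period-sum s P∤s (Window-++ˡ s p W))
                                        (sum-of-periods k (s + P) (Window-++ʳ s p W) P∤s+P) ⟩
    B G Δ p ∙ times G k (B G Δ p)   ∎
    where
    P∤s+P : ¬ P ∣ s + P
    P∤s+P P∣ = P∤s (Signed.∣⇒∣ᵤ (Signed.∣m+n∣n⇒∣m {P} {s} (Signed.∣ᵤ⇒∣ P∣) Signed.∣-refl))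

lemma5p3 : {c ℓ : Level} (G : AbelianGroup c ℓ) (N p : ℕ) (Δ : ℤ → AbelianGroup.Carrier G) →
    2 ℕ.≤ N → APAP G N p Δ →
    (k : ℕ) (s : ℤ) → (∀ (t : ℕ) → t ℕ.< k ℕ.* p → InRange N (s + + t)) → ¬ (+ p ∣ s) →
    AbelianGroup._≈_ G (sumFrom G Δ s (k ℕ.* p)) (times G k (B G Δ p))
-- The hypothesis 2 ≤ N is implied by 2 ≤ p ≤ N.
lemma5p3 G N p Δ _ apap = Periods.sum-of-periods G apap
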